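{- Let $v_1v_2v_3v_4$ be a 4-cycle and let $L(v_1)=L(v_2)=\{1,2,3,4\}$, $L(v_3)=\{1,2,3,5\}$, $L(v_4)=\{2,3,4,5\}$. Then $L$ is $4_{out}$-forcing for $v_1$ and for $v_2$. Further, if $G$ consists of a 4-cycle together with a path of length at least 1 that is pendant at one vertex of the cycle, then there exists a 4-assignment for $G$ that is $4_{out}$-forcing for each vertex of the path, and also for the vertex of degree 3 and for one of its neighbors on the cycle.
   Context: A 4-assignment $L$ assigns to each vertex $v$ a set $L(v)$ of exactly 4 colors. A 2-fold $L$-coloring is a function $\varphi$ with $\varphi(v)\subseteq L(v)$, $|\varphi(v)|=2$ for all $v$, and $\varphi(x)\cap\varphi(y)=\emptyset$ for every edge $xy$. $L$ is $4_{out}$-forcing for a vertex $v$ if there are two 2-subsets $A,B$ of $L(v)$ with $|A\cap B|=1$ such that no 2-fold $L$-coloring $\varphi$ has $\varphi(v)\in\{A,B\}$. A path pendant at a cycle vertex $u$ is a path sharing only its endpoint $u$ with the cycle. -}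

module Defs where

open import Data.Nat using (ℕ; zero; suc; _+_)
open import Data.Nat.Properties using (_≟_)
open import Data.Fin using (Fin; zero; suc; _↑ˡ_; _↑ʳ_; inject₁)
open import Data.List using (List; []; _∷_; length; filter)
open import Data.List.Relation.Unary.Unique.Propositional using (Unique)
open import Data.List.Membership.DecPropositional _≟_ using (_∈_; _∈?_)
open import Data.List.Relation.Binary.Subset.Propositional using (_⊆_)
open import Data.Product using (Σ; _×_)
open import Data.Sum using (_⊎_)
open import Data.Empty using (⊥)
open import Relation.Binary.PropositionalEquality using (_≡_)
open import Relation.Nullary using (¬_)

-- Colors are natural numbers; a finite set of colors is a duplicate-free list.
Color : Set
Color = ℕ

IsKSet : ℕ → List Color → Set
IsKSet k S = Unique S × length S ≡ k

_≋_ : List Color → List Color → Set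
A ≋ B = (A ⊆ B) × (B ⊆ A)

-- |A ∩ B|  (for duplicate-free A)
∣_∩_∣ : List Color → List Color → ℕ
∣ A ∩ B ∣ = length (filter (_∈? B) A)

Graph : ℕ → Set₁
Graph n = Fin n → Fin n → Set

Assignment : ℕ → Set
Assignment n = Fin n → List Color

IsKAssignment : (k : ℕ) {n : ℕ} → Assignment n → Set
IsKAssignment k L = ∀ v → IsKSet k (L v)

Is2FoldColoring : {n : ℕ} → Graph n → Assignment n → (Fin n → List Color) → Set
Is2FoldColoring {n} G L φ =
  (∀ v → (φ v ⊆ L v) × IsKSet 2 (φ v)) ×
  (∀ x y → G x y → ∀ c → c ∈ φ x → c ∈ φ y → ⊥)

Is4outForcing : {n : ℕ} → Graph n → Assignment n → Fin n → Set
Is4outForcing {n} G L v =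
  Σ (List Color) λ A → Σ (List Color) λ B →
    (IsKSet 2 A × A ⊆ L v) × (IsKSet 2 B × B ⊆ L v) × (∣ A ∩ B ∣ ≡ 1) ×
    (∀ (φ : Fin n → List Color) → Is2FoldColoring G L φ → ¬ ((φ v ≋ A) ⊎ (φ v ≋ B)))

Sym : {n : ℕ} → Graph n → Graph n
Sym E x y = E x y ⊎ E y x

next4 : Fin 4 → Fin 4
next4 zero = suc zero
next4 (suc zero) = suc (suc zero)
next4 (suc (suc zero)) = suc (suc (suc zero))
next4 (suc (suc (suc zero))) = zero

-- The 4-cycle v1 v2 v3 v4 on Fin 4 (vertex i ↦ v_{i+1}).
data C4Edge : Fin 4 → Fin 4 → Set where
  cyc : ∀ i → C4Edge i (next4 i)

C4 : Graph 4
C4 = Sym C4Edge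

-- The 4-cycle (vertices i ↑ˡ k, i : Fin 4) with a path of length k
-- pendant at cycle vertex 0.  Path vertices p 0 = cycle vertex 0, p (suc i) = 4 ↑ʳ i.
pathVertex : (k : ℕ) → Fin (suc k) → Fin (4 + k)
pathVertex k zero = zero ↑ˡ k
pathVertex k (suc i) = 4 ↑ʳ i

cycVertex : (k : ℕ) → Fin 4 → Fin (4 + k)
cycVertex k i = i ↑ˡ k

data CPEdge (k : ℕ) : Fin (4 + k) → Fin (4 + k) → Set where
  cyc  : ∀ i → CPEdge k (cycVertex k i) (cycVertex k (next4 i))
  path : ∀ (i : Fin k) → CPEdge k (pathVertex k (inject₁ i)) (pathVertex k (suc i))

CyclePlusPath : (k : ℕ) → Graph (4 + k)
CyclePlusPath k = Sym (CPEdge k)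

L₀ : Assignment 4
L₀ zero = 1 ∷ 2 ∷ 3 ∷ 4 ∷ []
L₀ (suc zero) = 1 ∷ 2 ∷ 3 ∷ 4 ∷ []
L₀ (suc (suc zero)) = 1 ∷ 2 ∷ 3 ∷ 5 ∷ []
L₀ (suc (suc (suc zero))) = 2 ∷ 3 ∷ 4 ∷ 5 ∷ []

-- Two adjacent vertices with the same list S = {1,2,3,4} receive complementary 2-sets, so if the
-- pair {A, B} is excluded at one of them, the pair {S ∖ A, S ∖ B} is excluded at the other; and
-- S ∖ {2,4} = {1,3}, S ∖ {3,4} = {1,2} again meet in one colour.  It therefore suffices to exclude
-- {2,4}, {3,4} at v₁ and {1,3}, {1,2} at v₂, which is a short chase around the 4-cycle: the two
-- neighbours of the chosen vertex are forced, and the opposite vertex is left with one colour.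
module Submission where

open import Defs
open import Data.Nat using (ℕ; suc; _+_; _≤_; z≤n; s≤s)
open import Data.Nat.Properties using (_≟_)
open import Data.Fin using (Fin; zero; suc; inject₁; splitAt)
open import Data.Fin.Induction using (<-weakInduction)
open import Data.Product using (Σ; _×_; _,_; proj₁; proj₂)
open import Data.Sum using (_⊎_; inj₁; inj₂; [_,_]′)
open import Data.Bool using (Bool; true; false; not)
open import Data.List using (List; []; _∷_; length; filter)
open import Data.List.Relation.Unary.Any using (here; there)
open import Data.List.Relation.Unary.All using ([]; _∷_)
open import Data.List.Relation.Unary.AllPairs using (_∷_)
open import Data.List.Relation.Unary.Unique.DecPropositional _≟_ using (unique?)
open import Data.List.Membership.DecPropositional _≟_ using (_∈_; _∉?_)
open import Data.List.Membership.Propositional.Properties using (∈-filter⁺)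
open import Data.List.Relation.Binary.Subset.DecPropositional _≟_ using (_⊆_; _⊆?_)
open import Function using (_∘_; const)
open import Relation.Binary.PropositionalEquality using (_≡_; refl)
open import Relation.Nullary using (¬_)
open import Relation.Nullary.Decidable using (True; toWitness)

infixl 6 _∖_

_∖_ : List Color → List Color → List Color
S ∖ A = filter (_∉? A) S

decide-isKSet : (S : List Color) → {True (unique? S)} → IsKSet (length S) S
decide-isKSet S {distinct} = toWitness distinct , refl

decide-⊆ : (A S : List Color) → {True (A ⊆? S)} → A ⊆ S
decide-⊆ A S {A⊆S} = toWitness A⊆S

pair-fills : ∀ {P S : List Color} → IsKSet 2 P → P ⊆ S → length S ≡ 2 → S ⊆ P
pair-fills {a ∷ b ∷ []} {x ∷ y ∷ []} ((a≢b ∷ []) ∷ _ , _) P⊆S refl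
  with P⊆S (here refl) | P⊆S (there (here refl))
... | here refl         | here refl         with () ← a≢b refl
... | there (here refl) | there (here refl) with () ← a≢b refl
... | here refl         | there (here refl) = λ { (here refl)         → here refl
                                                ; (there (here refl)) → there (here refl) }
... | there (here refl) | here refl         = λ { (here refl)         → there (here refl)
                                                ; (there (here refl)) → here refl }

pair-⊈-short : ∀ {P S : List Color} → IsKSet 2 P → length S ≤ 1 → ¬ P ⊆ S
pair-⊈-short {a ∷ b ∷ []} {[]} _ _ P⊆S with () ← P⊆S (here refl)
pair-⊈-short {a ∷ b ∷ []} {x ∷ []} ((a≢b ∷ []) ∷ _ , _) _ P⊆S
  with P⊆S (here refl) | P⊆S (there (here refl))
... | here refl | here refl = a≢b refl
pair-⊈-short {S = _ ∷ _ ∷ _} _ (s≤s ()) _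

module _ {n} {G : Graph n} {L : Assignment n} {φ : Fin n → List Color}
         (coloring : Is2FoldColoring G L φ) where

  colored-within : ∀ {v S} → L v ≡ S → φ v ⊆ S
  colored-within {v} refl = proj₁ (proj₁ coloring v)

  colored-pair : ∀ v → IsKSet 2 (φ v)
  colored-pair v = proj₂ (proj₁ coloring v)

  avoid-neighbour : ∀ {x y A S} → G x y → A ⊆ φ x → φ y ⊆ S → φ y ⊆ S ∖ A
  avoid-neighbour {x} {y} {A} xy A⊆φx φy⊆S {c} c∈φy =
    ∈-filter⁺ (_∉? A) (φy⊆S c∈φy) (λ c∈A → proj₂ coloring x y xy c (A⊆φx c∈A) c∈φy)

  forced-neighbour : ∀ {x y A S} → G x y → A ⊆ φ x → L y ≡ S → length (S ∖ A) ≡ 2 →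
                     S ∖ A ⊆ φ y
  forced-neighbour xy A⊆φx Ly≡S =
    pair-fills (colored-pair _) (avoid-neighbour xy A⊆φx (colored-within Ly≡S))

Excludes : ∀ {n} → Graph n → Assignment n → Fin n → List Color → Set
Excludes {n} G L v A = ∀ (φ : Fin n → List Color) → Is2FoldColoring G L φ → ¬ A ⊆ φ v

ExcludesBoth : ∀ {n} → Graph n → Assignment n → Fin n → List Color × List Color → Set
ExcludesBoth G L v (A , B) = Excludes G L v A × Excludes G L v B

excludesBoth⇒4outForcing : ∀ {n} {G : Graph n} {L v S A B} → L v ≡ S →
  IsKSet 2 A → A ⊆ S → IsKSet 2 B → B ⊆ S → ∣ A ∩ B ∣ ≡ 1 →
  ExcludesBoth G L v (A , B) → Is4outForcing G L v
excludesBoth⇒4outForcing {A = A} {B} refl kA A⊆S kB B⊆S A∩B (exA , exB) =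
  A , B , (kA , A⊆S) , (kB , B⊆S) , A∩B ,
  λ φ coloring → [ exA φ coloring ∘ proj₂ , exB φ coloring ∘ proj₂ ]′

square-excludes : ∀ {n} {G : Graph n} {L a b c d Sb Sc Sd} (A : List Color) →
  G a b → G a d → G b c → G d c → L b ≡ Sb → L c ≡ Sc → L d ≡ Sd →
  length (Sb ∖ A) ≡ 2 → length (Sd ∖ A) ≡ 2 → length (Sc ∖ (Sb ∖ A) ∖ (Sd ∖ A)) ≤ 1 →
  Excludes G L a A
square-excludes A ab ad bc dc Lb Lc Ld two-b two-d short-c φ coloring A⊆φa =
  pair-⊈-short (colored-pair coloring _) short-c
    (avoid-neighbour coloring dc (forced-neighbour coloring ad A⊆φa Ld two-d)
      (avoid-neighbour coloring bc (forced-neighbour coloring ab A⊆φa Lb two-b)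
        (colored-within coloring Lc)))

excludes-across : ∀ {n} {G : Graph n} {L u w S} (B : List Color) →
  G w u → L u ≡ S → length (S ∖ B) ≡ 2 → Excludes G L u (S ∖ B) → Excludes G L w B
excludes-across B wu Lu two ex φ coloring B⊆φw =
  ex φ coloring (forced-neighbour coloring wu B⊆φw Lu two)

oneToFour : List Color
oneToFour = 1 ∷ 2 ∷ 3 ∷ 4 ∷ []

forcedPair : Bool → List Color × List Color
forcedPair true  = 2 ∷ 4 ∷ [] , 3 ∷ 4 ∷ []
forcedPair false = 1 ∷ 3 ∷ [] , 1 ∷ 2 ∷ []

forcedPair-across : ∀ {n} {G : Graph n} {L u w} b → G w u → L u ≡ oneToFour →
  ExcludesBoth G L u (forcedPair b) → ExcludesBoth G L w (forcedPair (not b))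
forcedPair-across true  wu Lu (exA , exB) =
  excludes-across _ wu Lu refl exA , excludes-across _ wu Lu refl exB
forcedPair-across false wu Lu (exA , exB) =
  excludes-across _ wu Lu refl exA , excludes-across _ wu Lu refl exB

forcedPair-4outForcing : ∀ {n} {G : Graph n} {L v} b → L v ≡ oneToFour →
  ExcludesBoth G L v (forcedPair b) → Is4outForcing G L v
forcedPair-4outForcing true  Lv =
  excludesBoth⇒4outForcing Lv (decide-isKSet _) (decide-⊆ _ _) (decide-isKSet _) (decide-⊆ _ _) refl
forcedPair-4outForcing false Lv =
  excludesBoth⇒4outForcing Lv (decide-isKSet _) (decide-⊆ _ _) (decide-isKSet _) (decide-⊆ _ _) refl

record L₀Square {n} (G : Graph n) (L : Assignment n) : Set where
  field
    corner : Fin 4 → Fin n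
    side   : ∀ i → G (corner i) (corner (next4 i))
    side⁻  : ∀ i → G (corner (next4 i)) (corner i)
    lists  : ∀ i → L (corner i) ≡ L₀ i

module _ {n} {G : Graph n} {L : Assignment n} (Q : L₀Square G L) where
  open L₀Square Q

  private
    v₁ v₂ v₃ v₄ : Fin 4
    v₁ = zero
    v₂ = suc zero
    v₃ = suc (suc zero)
    v₄ = suc (suc (suc zero))

  L₀Square-excludes₁ : ExcludesBoth G L (corner v₁) (forcedPair true)
  L₀Square-excludes₁ = excludes _ refl refl (s≤s z≤n) , excludes _ refl refl (s≤s z≤n)
    where
    excludes : ∀ A → length (L₀ v₂ ∖ A) ≡ 2 → length (L₀ v₄ ∖ A) ≡ 2 →
               length (L₀ v₃ ∖ (L₀ v₂ ∖ A) ∖ (L₀ v₄ ∖ A)) ≤ 1 → Excludes G L (corner v₁) A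
    excludes A = square-excludes A (side v₁) (side⁻ v₄) (side v₂) (side⁻ v₃)
                   (lists v₂) (lists v₃) (lists v₄)

  L₀Square-excludes₂ : ExcludesBoth G L (corner v₂) (forcedPair false)
  L₀Square-excludes₂ = excludes _ refl refl (s≤s z≤n) , excludes _ refl refl (s≤s z≤n)
    where
    excludes : ∀ A → length (L₀ v₁ ∖ A) ≡ 2 → length (L₀ v₃ ∖ A) ≡ 2 →
               length (L₀ v₄ ∖ (L₀ v₁ ∖ A) ∖ (L₀ v₃ ∖ A)) ≤ 1 → Excludes G L (corner v₂) A
    excludes A = square-excludes A (side⁻ v₁) (side v₂) (side⁻ v₄) (side v₃)
                   (lists v₁) (lists v₄) (lists v₃)

  L₀Square-4outForcing₁ : Is4outForcing G L (corner v₁)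
  L₀Square-4outForcing₁ = forcedPair-4outForcing true (lists v₁) L₀Square-excludes₁

  L₀Square-4outForcing₂ : Is4outForcing G L (corner v₂)
  L₀Square-4outForcing₂ = forcedPair-4outForcing false (lists v₂) L₀Square-excludes₂

C4-L₀Square : L₀Square C4 L₀
C4-L₀Square = record
  { corner = λ i → i ; side = inj₁ ∘ cyc ; side⁻ = inj₂ ∘ cyc ; lists = λ _ → refl }

L₀-isKAssignment : IsKAssignment 4 L₀
L₀-isKAssignment zero                   = decide-isKSet _
L₀-isKAssignment (suc zero)             = decide-isKSet _
L₀-isKAssignment (suc (suc zero))       = decide-isKSet _
L₀-isKAssignment (suc (suc (suc zero))) = decide-isKSet _

L₀WithPath : (k : ℕ) → Assignment (4 + k)
L₀WithPath k = [ L₀ , const oneToFour ]′ ∘ splitAt 4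

module _ (k : ℕ) where
  private
    G = CyclePlusPath k
    L = L₀WithPath k

  L₀WithPath-isKAssignment : IsKAssignment 4 L
  L₀WithPath-isKAssignment v with splitAt 4 v
  ... | inj₁ i = L₀-isKAssignment i
  ... | inj₂ _ = decide-isKSet _

  CyclePlusPath-L₀Square : L₀Square G L
  CyclePlusPath-L₀Square = record
    { corner = cycVertex k ; side = inj₁ ∘ cyc ; side⁻ = inj₂ ∘ cyc ; lists = lists }
    where
    lists : ∀ i → L (cycVertex k i) ≡ L₀ i
    lists zero                   = refl
    lists (suc zero)             = refl
    lists (suc (suc zero))       = refl
    lists (suc (suc (suc zero))) = refl

  L₀WithPath-path : ∀ j → L (pathVertex k j) ≡ oneToFour
  L₀WithPath-path zero    = refl
  L₀WithPath-path (suc j) = refl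

  path-excludes : ∀ j → Σ Bool λ b → ExcludesBoth G L (pathVertex k j) (forcedPair b)
  path-excludes = <-weakInduction _ (true , L₀Square-excludes₁ CyclePlusPath-L₀Square)
    λ i (b , ex) → not b , forcedPair-across b (inj₂ (path i)) (L₀WithPath-path (inject₁ i)) ex

  path-4outForcing : ∀ j → Is4outForcing G L (pathVertex k j)
  path-4outForcing j with path-excludes j
  ... | b , ex = forcedPair-4outForcing b (L₀WithPath-path j) ex

lemma12 : (Is4outForcing C4 L₀ zero × Is4outForcing C4 L₀ (suc zero))
    × (∀ (k : ℕ) → Σ (Assignment (4 + suc k)) λ L →
         IsKAssignment 4 L
         × (∀ (i : Fin (suc (suc k))) → Is4outForcing (CyclePlusPath (suc k)) L (pathVertex (suc k) i))
         × Is4outForcing (CyclePlusPath (suc k)) L (cycVertex (suc k) zero)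
         × (Is4outForcing (CyclePlusPath (suc k)) L (cycVertex (suc k) (suc zero))
            ⊎ Is4outForcing (CyclePlusPath (suc k)) L (cycVertex (suc k) (suc (suc (suc zero))))))
lemma12 =
  (L₀Square-4outForcing₁ C4-L₀Square , L₀Square-4outForcing₂ C4-L₀Square) ,
  λ k → L₀WithPath (suc k) , L₀WithPath-isKAssignment (suc k) , path-4outForcing (suc k) ,
        L₀Square-4outForcing₁ (CyclePlusPath-L₀Square (suc k)) ,
        inj₁ (L₀Square-4outForcing₂ (CyclePlusPath-L₀Square (suc k)))
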